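{- Let $a,h,d,k$ be positive integers with $\gcd(a,d)=1$, $a>2$ and $3\leq 2k+1\leq a-1$, and let $A=(a,\ ha+d,\ ha+3d,\ ha+5d,\ \dots,\ ha+(2k+1)d)$. Write $a-1=(2k+1)s+t$ with $1\leq t\leq 2k+1$. If $t$ is even, then $$g(A)=ha\Big(\Big\lfloor \frac{a-2}{2k+1}\Big\rfloor +2\Big)+(a-1)d-a.$$ If $t$ is odd, then $$g(A)=\max \Big\{ ha\Big(\Big\lfloor \frac{a-2}{2k+1}\Big\rfloor +1\Big)+(a-1)d-a,\ ha\Big(\Big\lfloor \frac{a-3}{2k+1}\Big\rfloor +2\Big)+(a-2)d-a\Big\}.$$ Furthermore, $$n(A)=hs\Big(ks+t+\frac{1}{2}s-\frac{1}{2}\Big)+(a-1)\Big(\frac{d}{2}+h-\frac{1}{2}\Big)+h\Big\lfloor\frac{t}{2}\Big\rfloor.$$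
   Context: For a vector $A=(a_1,\dots,a_n)$ of positive integers with $\gcd(A)=1$, an integer $a_0\geq 0$ is representable by $A$ if $a_0=\sum_i a_ix_i$ for some $x_i\in\mathbb{N}=\{0,1,2,\dots\}$. Let $\mathcal{NR}(A)$ be the (finite) set of nonnegative integers not representable by $A$. The Frobenius number is $g(A)=\max\mathcal{NR}(A)$ and the Sylvester number is $n(A)=\#\mathcal{NR}(A)$. -}

module Defs where

open import Data.Nat using (ℕ; suc; _+_; _*_; _≤_)
open import Data.Fin using (Fin; toℕ)
open import Data.Vec using (Vec; _∷_; tabulate; zipWith; sum)
open import Data.List using (List; length)
open import Data.List.Membership.Propositional using (_∈_)
open import Data.List.Relation.Unary.Unique.Propositional using (Unique)
open import Data.Product using (Σ; ∃; _×_)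
open import Relation.Nullary using (¬_)
open import Relation.Binary.PropositionalEquality using (_≡_)

Representable : ∀ {n} → Vec ℕ n → ℕ → Set
Representable {n} A m = ∃ λ (x : Vec ℕ n) → sum (zipWith _*_ A x) ≡ m

IsFrobeniusNumber : ∀ {n} → Vec ℕ n → ℕ → Set
IsFrobeniusNumber A g =
  ¬ Representable A g × (∀ m → ¬ Representable A m → m ≤ g)

IsSylvesterNumber : ∀ {n} → Vec ℕ n → ℕ → Set
IsSylvesterNumber A N =
  Σ (List ℕ) λ L → Unique L × (∀ m → (m ∈ L → ¬ Representable A m)
                                    × (¬ Representable A m → m ∈ L))
                 × length L ≡ N

genVec : (a h d k : ℕ) → Vec ℕ (suc (suc k))
genVec a h d k = a ∷ tabulate (λ (i : Fin (suc k)) → h * a + (2 * toℕ i + 1) * d)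

{-# OPTIONS --safe #-}
-- A representation by A is n = a x₀ + h a X + d Y where Y is a sum of X odd numbers from
-- 1, 3, …, m = 2k + 1, i.e. X ≤ Y ≤ m X and X ≡ Y (mod 2). As gcd(a, d) = 1, the numbers d Y with Y < a
-- meet every class mod a exactly once, and the least representable element of the class of d Y is the
-- Apéry element h a minParts(Y) + d Y, where minParts(Y) is the least admissible X: any other choice
-- adds a multiple of a to Y or uses more parts. Hence g(A) is the largest Apéry element minus a, and
-- n(A) = Σ_{Y<a} ⌊Apéry(Y) / a⌋ = h Σ minParts(Y) + (a − 1)(d − 1)/2, since the carries ⌊d Y / a⌋ and
-- ⌊d (a − Y) / a⌋ add up to d − 1. Both are then evaluated from minParts(y + 1) = ⌊y/m⌋ + 1 + (y mod m mod 2).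
module Submission where

open import Defs
open import Data.Nat
open import Data.Nat.Properties
open import Data.Nat.DivMod
open import Data.Nat.Divisibility using (divides; ∣m+n∣m⇒∣n; n∣m*n; ∣⇒≤)
open import Data.Nat.GCD using (gcd; module Bézout)
open import Data.Nat.Coprimality using (Coprime; coprime-divisor; coprime-Bézout; gcd≡1⇒coprime)
import Data.Nat.Coprimality as Coprimality
open import Data.Nat.Tactic.RingSolver using (solve-∀)
open import Data.Fin using (Fin; toℕ; fromℕ<; fromℕ) renaming (zero to fzero; suc to fsuc)
open import Data.Fin.Properties using (toℕ≤pred[n]; toℕ-fromℕ<; toℕ-fromℕ)
open import Data.Vec using (Vec; _∷_; []; tabulate; zipWith; sum; replicate)
open import Data.List using (List; []; _++_; map; upTo; length)
open import Data.List.Properties using (length-++; length-map; length-upTo)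
open import Data.List.Membership.Propositional using (_∈_)
open import Data.List.Membership.Propositional.Properties
  using (∈-++⁺ˡ; ∈-++⁺ʳ; ∈-++⁻; ∈-map⁺; ∈-map⁻; ∈-upTo⁺; ∈-upTo⁻)
open import Data.List.Relation.Unary.Unique.Propositional using (Unique; [])
open import Data.List.Relation.Unary.Unique.Propositional.Properties using (++⁺; map⁺; upTo⁺)
open import Data.Product using (∃; _×_; _,_; proj₁; proj₂)
open import Data.Sum using (_⊎_; inj₁; inj₂; [_,_]′)
open import Data.Empty using (⊥-elim)
open import Relation.Binary.PropositionalEquality
  using (_≡_; _≢_; refl; sym; trans; cong; cong₂; subst; module ≡-Reasoning)
open import Relation.Nullary using (yes; no; ¬_)

sumBelow : (ℕ → ℕ) → ℕ → ℕ
sumBelow f zero    = 0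
sumBelow f (suc n) = sumBelow f n + f n

sumBelow-shift : ∀ f n → sumBelow f (suc n) ≡ f 0 + sumBelow (λ i → f (suc i)) n
sumBelow-shift f zero    = +-comm 0 (f 0)
sumBelow-shift f (suc n) = trans (cong (_+ f (suc n)) (sumBelow-shift f n)) (+-assoc (f 0) _ _)

sumBelow-+ : ∀ f g n → sumBelow (λ i → f i + g i) n ≡ sumBelow f n + sumBelow g n
sumBelow-+ f g zero    = refl
sumBelow-+ f g (suc n) rewrite sumBelow-+ f g n = lemma (sumBelow f n) (sumBelow g n) (f n) (g n)
  where lemma : ∀ A B C D → A + B + (C + D) ≡ A + C + (B + D)
        lemma = solve-∀

sumBelow-* : ∀ c f n → sumBelow (λ i → c * f i) n ≡ c * sumBelow f n
sumBelow-* c f zero    = sym (*-zeroʳ c)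
sumBelow-* c f (suc n) rewrite sumBelow-* c f n = sym (*-distribˡ-+ c (sumBelow f n) (f n))

sumBelow-cong : ∀ f g n → (∀ i → i < n → f i ≡ g i) → sumBelow f n ≡ sumBelow g n
sumBelow-cong f g zero    _  = refl
sumBelow-cong f g (suc n) eq =
  cong₂ _+_ (sumBelow-cong f g n (λ i i<n → eq i (m<n⇒m<1+n i<n))) (eq n ≤-refl)

sumBelow-const : ∀ c n → sumBelow (λ _ → c) n ≡ n * c
sumBelow-const c zero    = refl
sumBelow-const c (suc n) rewrite sumBelow-const c n = +-comm (n * c) c

sumBelow-reverse : ∀ f n → sumBelow f n ≡ sumBelow (λ i → f (n ∸ suc i)) n
sumBelow-reverse f zero    = refl
sumBelow-reverse f (suc n) = begin
  sumBelow f n + f n                                    ≡⟨ cong (_+ f n) (sumBelow-reverse f n) ⟩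
  sumBelow (λ i → f (n ∸ suc i)) n + f n                ≡⟨ +-comm _ (f n) ⟩
  f n + sumBelow (λ i → f (n ∸ suc i)) n                ≡⟨ sumBelow-shift (λ i → f (suc n ∸ suc i)) n ⟨
  sumBelow (λ i → f (suc n ∸ suc i)) (suc n)            ∎
  where open ≡-Reasoning

weightedSum : ∀ {n} → (Fin n → ℕ) → Vec ℕ n → ℕ
weightedSum g xs = sum (zipWith _*_ (tabulate g) xs)

weightedSum-affine : ∀ {n} c d (g : Fin n → ℕ) xs →
  weightedSum (λ i → c + g i * d) xs ≡ c * sum xs + d * weightedSum g xs
weightedSum-affine c d g []       = sym (cong₂ _+_ (*-zeroʳ c) (*-zeroʳ d))
weightedSum-affine c d g (x ∷ xs) rewrite weightedSum-affine c d (λ i → g (fsuc i)) xs =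
  lemma c d (g fzero) x (sum xs) (weightedSum (λ i → g (fsuc i)) xs)
  where lemma : ∀ c d G x S T → (c + G * d) * x + (c * S + d * T) ≡ c * (x + S) + d * (G * x + T)
        lemma = solve-∀

weightedSum-odd : ∀ {n} (g : Fin n → ℕ) xs →
  weightedSum (λ i → 2 * g i + 1) xs ≡ sum xs + 2 * weightedSum g xs
weightedSum-odd g []       = refl
weightedSum-odd g (x ∷ xs) rewrite weightedSum-odd (λ i → g (fsuc i)) xs =
  lemma (g fzero) x (sum xs) (weightedSum (λ i → g (fsuc i)) xs)
  where lemma : ∀ G x S T → (2 * G + 1) * x + (S + 2 * T) ≡ x + S + 2 * (G * x + T)
        lemma = solve-∀

weightedSum-≤ : ∀ {n} K (g : Fin n → ℕ) → (∀ i → g i ≤ K) → ∀ xs → weightedSum g xs ≤ K * sum xs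
weightedSum-≤ K g g≤K []       = z≤n
weightedSum-≤ K g g≤K (x ∷ xs) = begin
  g fzero * x + weightedSum (λ i → g (fsuc i)) xs ≤⟨ +-mono-≤ (*-monoˡ-≤ x (g≤K fzero))
                                                        (weightedSum-≤ K _ (λ i → g≤K (fsuc i)) xs) ⟩
  K * x + K * sum xs                              ≡⟨ *-distribˡ-+ K x (sum xs) ⟨
  K * (x + sum xs)                                ∎
  where open ≤-Reasoning

incrementAt : ∀ {n} → Fin n → Vec ℕ n → Vec ℕ n
incrementAt fzero    (x ∷ xs) = suc x ∷ xs
incrementAt (fsuc i) (x ∷ xs) = x ∷ incrementAt i xs

sum-incrementAt : ∀ {n} (i : Fin n) xs → sum (incrementAt i xs) ≡ suc (sum xs)
sum-incrementAt fzero    (x ∷ xs) = refl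
sum-incrementAt (fsuc i) (x ∷ xs) rewrite sum-incrementAt i xs = +-suc x (sum xs)

weightedSum-incrementAt : ∀ {n} (g : Fin n → ℕ) i xs → weightedSum g (incrementAt i xs) ≡ g i + weightedSum g xs
weightedSum-incrementAt g fzero (x ∷ xs) = lemma (g fzero) x (weightedSum (λ i → g (fsuc i)) xs)
  where lemma : ∀ G x T → G * suc x + T ≡ G + (G * x + T)
        lemma = solve-∀
weightedSum-incrementAt g (fsuc i) (x ∷ xs)
  rewrite weightedSum-incrementAt (λ i → g (fsuc i)) i xs =
  lemma (g fzero * x) (g (fsuc i)) (weightedSum (λ i → g (fsuc i)) xs)
  where lemma : ∀ A B C → A + (B + C) ≡ B + (A + C)
        lemma = solve-∀

sum-replicate-0 : ∀ n → sum (replicate n 0) ≡ 0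
sum-replicate-0 zero    = refl
sum-replicate-0 (suc n) = sum-replicate-0 n

weightedSum-replicate-0 : ∀ {n} (g : Fin n → ℕ) → weightedSum g (replicate n 0) ≡ 0
weightedSum-replicate-0 {zero}  g = refl
weightedSum-replicate-0 {suc n} g rewrite *-zeroʳ (g fzero) = weightedSum-replicate-0 (λ i → g (fsuc i))

-- Greedy filling: put each of the X units into the largest slot that keeps the weight ≤ j.
weightedSum-toℕ-surjective : ∀ k X j → j ≤ k * X →
  ∃ λ (xs : Vec ℕ (suc k)) → sum xs ≡ X × weightedSum toℕ xs ≡ j
weightedSum-toℕ-surjective k zero j j≤0 rewrite *-zeroʳ k with j≤0
... | z≤n = replicate (suc k) 0 , sum-replicate-0 (suc k) , weightedSum-replicate-0 {suc k} toℕ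
weightedSum-toℕ-surjective k (suc X) j j≤ with j ≤? k
... | yes j≤k =
  let xs , ∑xs , wxs = weightedSum-toℕ-surjective k X 0 z≤n
      i = fromℕ< (s≤s j≤k)
  in incrementAt i xs
   , trans (sum-incrementAt i xs) (cong suc ∑xs)
   , trans (weightedSum-incrementAt toℕ i xs)
       (trans (cong₂ _+_ (toℕ-fromℕ< (s≤s j≤k)) wxs) (+-identityʳ j))
... | no j≰k =
  let xs , ∑xs , wxs = weightedSum-toℕ-surjective k X (j ∸ k) j∸k≤
  in incrementAt (fromℕ k) xs
   , trans (sum-incrementAt (fromℕ k) xs) (cong suc ∑xs)
   , trans (weightedSum-incrementAt toℕ (fromℕ k) xs)
       (trans (cong₂ _+_ (toℕ-fromℕ k) wxs) (m+[n∸m]≡n (<⇒≤ (≰⇒> j≰k))))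
  where
  j∸k≤ : j ∸ k ≤ k * X
  j∸k≤ = begin
    j ∸ k           ≤⟨ ∸-monoˡ-≤ k (≤-trans j≤ (≤-reflexive (*-suc k X))) ⟩
    k + k * X ∸ k   ≡⟨ m+n∸m≡n k (k * X) ⟩
    k * X           ∎
    where open ≤-Reasoning

div-mod-unique : ∀ n m .{{_ : NonZero m}} q r → r < m → n ≡ r + q * m → n / m ≡ q × n % m ≡ r
div-mod-unique n m q r r<m n≡ = n/m≡q , n%m≡r
  where
  n%m≡r : n % m ≡ r
  n%m≡r = trans (cong (_% m) n≡) (trans ([m+kn]%n≡m%n r q m) (m<n⇒m%n≡m r<m))
  n/m≡q : n / m ≡ q
  n/m≡q = *-cancelʳ-≡ (n / m) q m (+-cancelˡ-≡ r _ _
            (trans (cong (_+ (n / m) * m) (sym n%m≡r)) (trans (sym (m≡m%n+[m/n]*n n m)) n≡)))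

even-or-odd : ∀ e → (e % 2 ≡ 0 × e ≡ 0 + e / 2 * 2) ⊎ (e % 2 ≡ 1 × e ≡ 1 + e / 2 * 2)
even-or-odd e with e % 2 | m%n<n e 2 | m≡m%n+[m/n]*n e 2
... | 0           | _              | e≡ = inj₁ (refl , e≡)
... | 1           | _              | e≡ = inj₂ (refl , e≡)
... | suc (suc _) | s≤s (s≤s ()) | _

%2≤1 : ∀ e → e % 2 ≤ 1
%2≤1 e = ≤-pred (m%n<n e 2)

odd-of-suc-even : ∀ e → suc e % 2 ≡ 0 → e % 2 ≡ 1
odd-of-suc-even e 1+e%2≡0 with even-or-odd e
... | inj₂ (e%2≡1 , _) = e%2≡1
... | inj₁ (_ , e≡) with trans (sym ([m+kn]%n≡m%n 1 (e / 2) 2)) (trans (cong (λ u → suc u % 2) (sym e≡)) 1+e%2≡0)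
...   | ()

even-of-suc-odd : ∀ e → suc e % 2 ≡ 1 → e % 2 ≡ 0
even-of-suc-odd e 1+e%2≡1 with even-or-odd e
... | inj₁ (e%2≡0 , _) = e%2≡0
... | inj₂ (_ , e≡) with trans (sym ([m+kn]%n≡m%n 0 (suc (e / 2)) 2)) (trans (cong (λ u → suc u % 2) (sym e≡)) 1+e%2≡1)
...   | ()

-- Y is a sum of X odd numbers 1 + 2 jᵢ with jᵢ ≤ k, and j = Σ jᵢ.
OddPartition : ℕ → ℕ → ℕ → Set
OddPartition k X Y = ∃ λ j → Y ≡ X + 2 * j × j ≤ k * X

RepresentableXY : (a c d k n : ℕ) → Set
RepresentableXY a c d k n =
  ∃ λ x₀ → ∃ λ X → ∃ λ Y → OddPartition k X Y × n ≡ a * x₀ + c * X + d * Y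

representable⇒XY : ∀ a h d k n → Representable (genVec a h d k) n → RepresentableXY a (h * a) d k n
representable⇒XY a h d k n (x₀ ∷ xs , ≡n) =
  x₀ , sum xs , weightedSum (λ i → 2 * toℕ i + 1) xs ,
  (weightedSum toℕ xs , weightedSum-odd toℕ xs , weightedSum-≤ k toℕ toℕ≤pred[n] xs) ,
  (begin
    n                                                                ≡⟨ ≡n ⟨
    a * x₀ + weightedSum (λ i → h * a + (2 * toℕ i + 1) * d) xs       ≡⟨ cong (a * x₀ +_) (weightedSum-affine (h * a) d (λ i → 2 * toℕ i + 1) xs) ⟩
    a * x₀ + (h * a * sum xs + d * weightedSum (λ i → 2 * toℕ i + 1) xs) ≡⟨ +-assoc (a * x₀) _ _ ⟨
    a * x₀ + h * a * sum xs + d * weightedSum (λ i → 2 * toℕ i + 1) xs   ∎)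
  where open ≡-Reasoning

XY⇒representable : ∀ a h d k n → RepresentableXY a (h * a) d k n → Representable (genVec a h d k) n
XY⇒representable a h d k n (x₀ , X , Y , (j , Y≡ , j≤) , n≡)
  with weightedSum-toℕ-surjective k X j j≤
... | xs , ∑xs , wxs = x₀ ∷ xs , (begin
    a * x₀ + weightedSum (λ i → h * a + (2 * toℕ i + 1) * d) xs
      ≡⟨ cong (a * x₀ +_) (weightedSum-affine (h * a) d (λ i → 2 * toℕ i + 1) xs) ⟩
    a * x₀ + (h * a * sum xs + d * weightedSum (λ i → 2 * toℕ i + 1) xs)
      ≡⟨ cong (λ u → a * x₀ + (h * a * sum xs + d * u)) (weightedSum-odd toℕ xs) ⟩
    a * x₀ + (h * a * sum xs + d * (sum xs + 2 * weightedSum toℕ xs))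
      ≡⟨ cong₂ (λ u v → a * x₀ + (h * a * u + d * (u + 2 * v))) ∑xs wxs ⟩
    a * x₀ + (h * a * X + d * (X + 2 * j))
      ≡⟨ +-assoc (a * x₀) _ _ ⟨
    a * x₀ + h * a * X + d * (X + 2 * j)
      ≡⟨ cong (λ u → a * x₀ + h * a * X + d * u) Y≡ ⟨
    a * x₀ + h * a * X + d * Y
      ≡⟨ n≡ ⟨
    n ∎)
  where open ≡-Reasoning

module MinimalPartition (k : ℕ) where

  m : ℕ
  m = suc (2 * k)

  minParts′ : ℕ → ℕ
  minParts′ y = y / m + y % m % 2

  minParts : ℕ → ℕ
  minParts zero    = 0
  minParts (suc y) = suc (minParts′ y)

  private
    y≡ : ∀ y → y ≡ y % m + y / m * m
    y≡ y = m≡m%n+[m/n]*n y m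

    half≤k : ∀ e → e < m → e / 2 ≤ k
    half≤k e e<m = *-cancelʳ-≤ (e / 2) k 2 (begin
      e / 2 * 2           ≤⟨ m≤n+m _ (e % 2) ⟩
      e % 2 + e / 2 * 2   ≡⟨ m≡m%n+[m/n]*n e 2 ⟨
      e                   ≤⟨ <⇒≤pred e<m ⟩
      2 * k               ≡⟨ *-comm 2 k ⟩
      k * 2               ∎)
      where open ≤-Reasoning

  minParts-oddPartition : ∀ Y → OddPartition k (minParts Y) Y
  minParts-oddPartition zero    = 0 , refl , z≤n
  minParts-oddPartition (suc y) = k * q + e / 2 , Y≡ , j≤
    where
    q = y / m
    e = y % m
    p = e % 2
    lemma : ∀ p w q k → suc (p + w * 2 + q * suc (2 * k)) ≡ suc (q + p) + 2 * (k * q + w)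
    lemma = solve-∀
    Y≡ : suc y ≡ suc (q + p) + 2 * (k * q + e / 2)
    Y≡ = trans (cong suc (trans (y≡ y) (cong (_+ q * m) (m≡m%n+[m/n]*n e 2)))) (lemma p (e / 2) q k)
    lemma₂ : ∀ k q p → k * q + k + k * p ≡ k * suc (q + p)
    lemma₂ = solve-∀
    j≤ : k * q + e / 2 ≤ k * suc (q + p)
    j≤ = ≤-trans (+-monoʳ-≤ (k * q) (half≤k e (m%n<n y m)))
                 (≤-trans (m≤m+n (k * q + k) (k * p)) (≤-reflexive (lemma₂ k q p)))

  oddPartition⇒≤ : ∀ {X Y} → OddPartition k X Y → Y ≤ m * X
  oddPartition⇒≤ {X} {Y} (j , Y≡ , j≤) = begin
    Y               ≡⟨ Y≡ ⟩
    X + 2 * j       ≤⟨ +-monoʳ-≤ X (*-monoʳ-≤ 2 j≤) ⟩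
    X + 2 * (k * X) ≡⟨ lemma X k ⟩
    m * X           ∎
    where
    open ≤-Reasoning
    lemma : ∀ X k → X + 2 * (k * X) ≡ suc (2 * k) * X
    lemma = solve-∀

  private
    quotient<parts : ∀ y X → suc y ≤ m * X → y / m < X
    quotient<parts y X y<mX = *-cancelˡ-< m (y / m) X (begin-strict
      m * (y / m)         ≡⟨ *-comm m (y / m) ⟩
      y / m * m           ≤⟨ m≤n+m _ (y % m) ⟩
      y % m + y / m * m   ≡⟨ y≡ y ⟨
      y                   <⟨ y<mX ⟩
      m * X               ∎)
      where open ≤-Reasoning

  -- An odd remainder forces X = q + 2 rather than q + 1, since X ≡ Y (mod 2).
  minParts-minimal : ∀ Y X → OddPartition k X Y → minParts Y ≤ X
  minParts-minimal zero    X _ = z≤n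
  minParts-minimal (suc y) X part@(j , Y≡ , _)
    with even-or-odd (y % m) | quotient<parts y X (oddPartition⇒≤ part)
  ... | inj₁ (p≡0 , _) | q<X rewrite p≡0 | +-identityʳ (y / m) = q<X
  ... | inj₂ (p≡1 , e≡) | q<X rewrite p≡1 | +-comm (y / m) 1 = ≤∧≢⇒< q<X q+1≢X
    where
    q = y / m
    w = y % m / 2
    lemma : ∀ w q k → suc q + suc (2 * (w + k * q)) ≡ suc ((1 + w * 2) + q * suc (2 * k))
    lemma = solve-∀
    q+1≢X : suc q ≢ X
    q+1≢X refl = even≢odd j (w + k * q) (sym (+-cancelˡ-≡ (suc q) _ _ (begin
      suc q + suc (2 * (w + k * q))     ≡⟨ lemma w q k ⟩
      suc ((1 + w * 2) + q * m)         ≡⟨ cong (λ u → suc (u + q * m)) e≡ ⟨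
      suc (y % m + q * m)               ≡⟨ cong suc (y≡ y) ⟨
      suc y                             ≡⟨ Y≡ ⟩
      suc q + 2 * j                     ∎)))
      where open ≡-Reasoning

  minParts-≤-of-gap : ∀ Y X Y′ → OddPartition k X Y′ → Y + suc m ≤ Y′ → minParts Y ≤ X
  minParts-≤-of-gap zero    X Y′ _    _      = z≤n
  minParts-≤-of-gap (suc y) X Y′ part Y+m<Y′ = begin
    suc (y / m + y % m % 2)  ≤⟨ s≤s (+-monoʳ-≤ (y / m) (%2≤1 (y % m))) ⟩
    suc (y / m + 1)          ≡⟨ cong suc (+-comm (y / m) 1) ⟩
    suc (suc (y / m))        ≤⟨ *-cancelˡ-< m (suc (y / m)) X (begin-strict
        m * suc (y / m)        ≡⟨ lemma m (y / m) ⟩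
        y / m * m + m          ≤⟨ +-monoˡ-≤ m (≤-trans (m≤n+m _ (y % m)) (≤-reflexive (sym (y≡ y)))) ⟩
        y + m                  <⟨ s≤s (+-monoˡ-≤ m (n≤1+n y)) ⟩
        suc (suc y + m)        ≡⟨ +-suc (suc y) m ⟨
        suc y + suc m          ≤⟨ Y+m<Y′ ⟩
        Y′                     ≤⟨ oddPartition⇒≤ part ⟩
        m * X                  ∎) ⟩
    X                        ∎
    where
    open ≤-Reasoning
    lemma : ∀ m q → m * suc q ≡ q * m + m
    lemma = solve-∀

  minParts′-value : ∀ q e → e < m → minParts′ (e + q * m) ≡ q + e % 2
  minParts′-value q e e<m = let q≡ , e≡ = div-mod-unique (e + q * m) m q e e<m refl in cong₂ _+_ q≡ (cong (_% 2) e≡)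

  private
    double-half-suc : ∀ e → 2 * (suc e / 2) ≡ 2 * (e / 2) + 2 * (e % 2)
    double-half-suc e with even-or-odd e
    ... | inj₁ (e%2≡0 , e≡) = begin
      2 * (suc e / 2)            ≡⟨ cong (2 *_) (proj₁ (div-mod-unique (suc e) 2 (e / 2) 1 (s≤s (s≤s z≤n)) (cong suc e≡))) ⟩
      2 * (e / 2)                ≡⟨ +-identityʳ _ ⟨
      2 * (e / 2) + 2 * 0        ≡⟨ cong (λ u → 2 * (e / 2) + 2 * u) e%2≡0 ⟨
      2 * (e / 2) + 2 * (e % 2)  ∎
      where open ≡-Reasoning
    ... | inj₂ (e%2≡1 , e≡) = begin
      2 * (suc e / 2)            ≡⟨ cong (2 *_) (proj₁ (div-mod-unique (suc e) 2 (suc (e / 2)) 0 (s≤s z≤n) (cong suc e≡))) ⟩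
      2 * suc (e / 2)            ≡⟨ *-suc 2 (e / 2) ⟩
      2 + 2 * (e / 2)            ≡⟨ +-comm 2 _ ⟩
      2 * (e / 2) + 2 * 1        ≡⟨ cong (λ u → 2 * (e / 2) + 2 * u) e%2≡1 ⟨
      2 * (e / 2) + 2 * (e % 2)  ∎
      where open ≡-Reasoning

    m/2≡k : m / 2 ≡ k
    m/2≡k = proj₁ (div-mod-unique m 2 k 1 (s≤s (s≤s z≤n)) (cong suc (*-comm 2 k)))

  -- Σ_{y < qm+e} minParts′ y = m q(q−1)/2 + k q + e q + ⌊e/2⌋, doubled and without subtraction.
  sum-minParts′ : ∀ q e → e ≤ m →
    2 * sumBelow minParts′ (e + q * m) + m * q ≡ m * q * q + 2 * k * q + 2 * q * e + 2 * (e / 2)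
  sum-minParts′ zero zero _ = lemma k
    where lemma : ∀ k → 0 + suc (2 * k) * 0 ≡ suc (2 * k) * 0 * 0 + 2 * k * 0 + 2 * 0 * 0 + 0
          lemma = solve-∀
  sum-minParts′ (suc q) zero _ = begin
    2 * S + m * suc q                                   ≡⟨ lemma₁ S k q ⟩
    2 * S + m * q + m                                   ≡⟨ cong (_+ m) (sum-minParts′ q m ≤-refl) ⟩
    m * q * q + 2 * k * q + 2 * q * m + 2 * (m / 2) + m ≡⟨ cong (λ u → m * q * q + 2 * k * q + 2 * q * m + 2 * u + m) m/2≡k ⟩
    m * q * q + 2 * k * q + 2 * q * m + 2 * k + m       ≡⟨ lemma₂ k q ⟩
    m * suc q * suc q + 2 * k * suc q + 2 * suc q * 0 + 0 ∎
    where
    open ≡-Reasoning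
    S = sumBelow minParts′ (m + q * m)
    lemma₁ : ∀ S k q → 2 * S + suc (2 * k) * suc q ≡ 2 * S + suc (2 * k) * q + suc (2 * k)
    lemma₁ = solve-∀
    lemma₂ : ∀ k q → suc (2 * k) * q * q + 2 * k * q + 2 * q * suc (2 * k) + 2 * k + suc (2 * k)
               ≡ suc (2 * k) * suc q * suc q + 2 * k * suc q + 2 * suc q * 0 + 0
    lemma₂ = solve-∀
  sum-minParts′ q (suc e) e<m = begin
    2 * (S + minParts′ (e + q * m)) + m * q
      ≡⟨ lemma₁ S (minParts′ (e + q * m)) (m * q) ⟩
    2 * S + m * q + 2 * minParts′ (e + q * m)
      ≡⟨ cong₂ _+_ (sum-minParts′ q e (<⇒≤ e<m)) (cong (2 *_) (minParts′-value q e e<m)) ⟩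
    m * q * q + 2 * k * q + 2 * q * e + 2 * (e / 2) + 2 * (q + e % 2)
      ≡⟨ lemma₂ (m * q * q + 2 * k * q) q e (e / 2) (e % 2) ⟩
    m * q * q + 2 * k * q + 2 * q * suc e + (2 * (e / 2) + 2 * (e % 2))
      ≡⟨ cong (m * q * q + 2 * k * q + 2 * q * suc e +_) (double-half-suc e) ⟨
    m * q * q + 2 * k * q + 2 * q * suc e + 2 * (suc e / 2) ∎
    where
    open ≡-Reasoning
    S = sumBelow minParts′ (e + q * m)
    lemma₁ : ∀ S F M → 2 * (S + F) + M ≡ 2 * S + M + 2 * F
    lemma₁ = solve-∀
    lemma₂ : ∀ A q e W p → A + 2 * q * e + 2 * W + 2 * (q + p) ≡ A + 2 * q * suc e + (2 * W + 2 * p)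
    lemma₂ = solve-∀

  sum-minParts : ∀ n → sumBelow minParts (suc n) ≡ n * 1 + sumBelow minParts′ n
  sum-minParts n = trans (sumBelow-shift minParts n) (trans (sumBelow-+ (λ _ → 1) minParts′ n)
                     (cong (_+ sumBelow minParts′ n) (sumBelow-const 1 n)))

module Residues (a₁ d₁ : ℕ) (coprime : Coprime (suc a₁) (suc d₁)) where

  a d : ℕ
  a = suc a₁
  d = suc d₁

  residue carry : ℕ → ℕ
  residue Y = d * Y % a
  carry   Y = d * Y / a

  dY≡ : ∀ Y → d * Y ≡ residue Y + carry Y * a
  dY≡ Y = m≡m%n+[m/n]*n (d * Y) a

  residue<a : ∀ Y → residue Y < a
  residue<a Y = m%n<n (d * Y) a

  residue-mod : ∀ Y → d * Y % a ≡ residue (Y % a)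
  residue-mod Y = begin
    d * Y % a                                   ≡⟨ cong (λ u → d * u % a) (m≡m%n+[m/n]*n Y a) ⟩
    d * (Y % a + Y / a * a) % a                 ≡⟨ cong (_% a) (lemma d (Y % a) (Y / a) a) ⟩
    (d * (Y % a) + d * (Y / a) * a) % a         ≡⟨ [m+kn]%n≡m%n (d * (Y % a)) (d * (Y / a)) a ⟩
    residue (Y % a)                             ∎
    where
    open ≡-Reasoning
    lemma : ∀ d x c a → d * (x + c * a) ≡ d * x + d * c * a
    lemma = solve-∀

  private
    residue-shift-injective : ∀ Y δ → Y + δ < a → residue Y ≡ residue (Y + δ) → δ ≡ 0
    residue-shift-injective Y zero     _      _ = refl
    residue-shift-injective Y (suc δ₁) Y+δ<a eq =
      ⊥-elim (<⇒≱ (≤-<-trans (m≤n+m (suc δ₁) Y) Y+δ<a) (∣⇒≤ (coprime-divisor coprime a∣dδ)))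
      where
      δ = suc δ₁
      carry-step : carry Y * a + d * δ ≡ carry (Y + δ) * a
      carry-step = +-cancelˡ-≡ (residue Y) _ _ (begin
        residue Y + (carry Y * a + d * δ)       ≡⟨ +-assoc (residue Y) _ _ ⟨
        residue Y + carry Y * a + d * δ         ≡⟨ cong (_+ d * δ) (dY≡ Y) ⟨
        d * Y + d * δ                           ≡⟨ *-distribˡ-+ d Y δ ⟨
        d * (Y + δ)                             ≡⟨ dY≡ (Y + δ) ⟩
        residue (Y + δ) + carry (Y + δ) * a     ≡⟨ cong (_+ carry (Y + δ) * a) eq ⟨
        residue Y + carry (Y + δ) * a           ∎)
        where open ≡-Reasoning
      a∣dδ = ∣m+n∣m⇒∣n (divides (carry (Y + δ)) carry-step) (n∣m*n (carry Y))

  residue-injective : ∀ Y Y′ → Y < a → Y′ < a → residue Y ≡ residue Y′ → Y ≡ Y′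
  residue-injective Y Y′ Y<a Y′<a eq with ≤-total Y Y′
  ... | inj₁ Y≤Y′ = trans (sym (+-identityʳ Y)) (trans (cong (Y +_) (sym δ≡0)) (m+[n∸m]≡n Y≤Y′))
    where
    Y+δ≡ = sym (m+[n∸m]≡n Y≤Y′)
    δ≡0 = residue-shift-injective Y (Y′ ∸ Y) (subst (_< a) Y+δ≡ Y′<a) (trans eq (cong residue Y+δ≡))
  ... | inj₂ Y′≤Y = sym (trans (sym (+-identityʳ Y′)) (trans (cong (Y′ +_) (sym δ≡0)) (m+[n∸m]≡n Y′≤Y)))
    where
    Y′+δ≡ = sym (m+[n∸m]≡n Y′≤Y)
    δ≡0 = residue-shift-injective Y′ (Y ∸ Y′) (subst (_< a) Y′+δ≡ Y<a) (trans (sym eq) (cong residue Y′+δ≡))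

  residue-determines : ∀ Y Y′ z w → Y < a → residue Y + z * a ≡ d * Y′ + w * a → Y′ ≡ Y + Y′ / a * a
  residue-determines Y Y′ z w Y<a eq =
    trans (m≡m%n+[m/n]*n Y′ a) (cong (_+ Y′ / a * a) (residue-injective (Y′ % a) Y (m%n<n Y′ a) Y<a (begin
      residue (Y′ % a)           ≡⟨ residue-mod Y′ ⟨
      d * Y′ % a                 ≡⟨ [m+kn]%n≡m%n (d * Y′) w a ⟨
      (d * Y′ + w * a) % a       ≡⟨ cong (_% a) eq ⟨
      (residue Y + z * a) % a    ≡⟨ [m+kn]%n≡m%n (residue Y) z a ⟩
      residue Y % a              ≡⟨ m%n%n≡m%n (d * Y) a ⟩
      residue Y                  ∎)))
    where open ≡-Reasoning

  inverse : ∃ λ u → d * u % a ≡ 1 % a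
  inverse with coprime-Bézout (Coprimality.sym coprime)
  ... | Bézout.+- x y 1+ya≡xd = x , (begin
    d * x % a          ≡⟨ cong (_% a) (trans (*-comm d x) (sym 1+ya≡xd)) ⟩
    (1 + y * a) % a    ≡⟨ [m+kn]%n≡m%n 1 y a ⟩
    1 % a              ∎)
    where open ≡-Reasoning
  ... | Bézout.-+ x y 1+xd≡ya = x * a₁ , (begin
    d * (x * a₁) % a                   ≡⟨ [m+kn]%n≡m%n (d * (x * a₁)) y a ⟨
    (d * (x * a₁) + y * a) % a         ≡⟨ cong (λ u → (d * (x * a₁) + u) % a) 1+xd≡ya ⟨
    (d * (x * a₁) + (1 + x * d)) % a   ≡⟨ cong (_% a) (lemma d x a₁) ⟩
    (1 + d * x * a) % a                ≡⟨ [m+kn]%n≡m%n 1 (d * x) a ⟩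
    1 % a                              ∎)
    where
    open ≡-Reasoning
    lemma : ∀ d x a₁ → d * (x * a₁) + (1 + x * d) ≡ 1 + d * x * suc a₁
    lemma = solve-∀

  residue-surjective : ∀ n → ∃ λ Y → Y < a × n ≡ residue Y + n / a * a
  residue-surjective n = Y , m%n<n (n * u) a ,
    trans (m≡m%n+[m/n]*n n a) (cong (_+ n / a * a) (sym residue≡))
    where
    u = proj₁ inverse
    Y = n * u % a
    residue≡ : residue Y ≡ n % a
    residue≡ = begin
      residue (n * u % a)              ≡⟨ residue-mod (n * u) ⟨
      d * (n * u) % a                  ≡⟨ cong (_% a) (trans (sym (*-assoc d n u)) (trans (cong (_* u) (*-comm d n)) (*-assoc n d u))) ⟩
      n * (d * u) % a                  ≡⟨ %-distribˡ-* n (d * u) a ⟩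
      n % a * (d * u % a) % a          ≡⟨ cong (λ v → n % a * v % a) (proj₂ inverse) ⟩
      n % a * (1 % a) % a              ≡⟨ %-distribˡ-* n 1 a ⟨
      n * 1 % a                        ≡⟨ cong (_% a) (*-identityʳ n) ⟩
      n % a                            ∎
      where open ≡-Reasoning

  residue≢0 : ∀ Y → 0 < Y → Y < a → residue Y ≢ 0
  residue≢0 Y 0<Y Y<a r≡0 = <⇒≱ Y<a (∣⇒≤ ⦃ >-nonZero 0<Y ⦄
    (coprime-divisor coprime (divides (carry Y) (trans (dY≡ Y) (cong (_+ carry Y * a) r≡0)))))

  -- Y ↦ a − Y negates the residue, so the carries of Y and a − Y add up to d − 1.
  carry-complement : ∀ Y Y′ → 0 < Y → Y < a → Y + Y′ ≡ a → carry Y + carry Y′ ≡ d₁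
  carry-complement Y Y′ 0<Y Y<a Y+Y′≡a = trans (cong (carry Y +_) carry≡c) (m+[n∸m]≡n carry≤d₁)
    where
    carry≤d₁ : carry Y ≤ d₁
    carry≤d₁ = ≤-pred (*-cancelʳ-< _ (carry Y) d (begin-strict
      carry Y * a                    ≤⟨ m≤n+m (carry Y * a) (residue Y) ⟩
      residue Y + carry Y * a        ≡⟨ dY≡ Y ⟨
      d * Y                          <⟨ s≤s (+-monoʳ-≤ Y (*-monoʳ-≤ d₁ (n≤1+n Y))) ⟩
      d * suc Y                      ≤⟨ *-monoʳ-≤ d Y<a ⟩
      d * a                          ∎))
      where open ≤-Reasoning
    u = a ∸ residue Y
    c = d₁ ∸ carry Y
    u<a : u < a
    u<a with residue Y | residue≢0 Y 0<Y Y<a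
    ... | zero   | r≢0 = ⊥-elim (r≢0 refl)
    ... | suc r₁ | _   = s≤s (m∸n≤m a₁ r₁)
    dY′≡ : residue Y + carry Y * a + d * Y′ ≡ residue Y + carry Y * a + (u + c * a)
    dY′≡ = begin
      residue Y + carry Y * a + d * Y′          ≡⟨ cong (_+ d * Y′) (dY≡ Y) ⟨
      d * Y + d * Y′                            ≡⟨ *-distribˡ-+ d Y Y′ ⟨
      d * (Y + Y′)                              ≡⟨ cong (d *_) Y+Y′≡a ⟩
      a + d₁ * a                                ≡⟨ cong₂ (λ x y → x + y * a) (m+[n∸m]≡n (<⇒≤ (residue<a Y))) (m+[n∸m]≡n carry≤d₁) ⟨
      residue Y + u + (carry Y + c) * a         ≡⟨ lemma (residue Y) u (carry Y) c a ⟩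
      residue Y + carry Y * a + (u + c * a)     ∎
      where
      open ≡-Reasoning
      lemma : ∀ R u B c a → R + u + (B + c) * a ≡ R + B * a + (u + c * a)
      lemma = solve-∀
    carry≡c : carry Y′ ≡ c
    carry≡c = proj₁ (div-mod-unique (d * Y′) a c u u<a (+-cancelˡ-≡ (residue Y + carry Y * a) _ _ dY′≡))

  sum-carry : 2 * sumBelow carry a ≡ a₁ * d₁
  sum-carry = begin
    2 * sumBelow carry a                                 ≡⟨ cong (2 *_) (sumBelow-shift carry a₁) ⟩
    2 * (carry 0 + sumBelow carry′ a₁)                   ≡⟨ cong (λ u → 2 * (u + sumBelow carry′ a₁)) carry0≡0 ⟩
    2 * sumBelow carry′ a₁                               ≡⟨ cong (sumBelow carry′ a₁ +_) (+-identityʳ _) ⟩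
    sumBelow carry′ a₁ + sumBelow carry′ a₁              ≡⟨ cong (sumBelow carry′ a₁ +_) (sumBelow-reverse carry′ a₁) ⟩
    sumBelow carry′ a₁ + sumBelow (λ i → carry′ (a₁ ∸ suc i)) a₁
      ≡⟨ sumBelow-+ carry′ (λ i → carry′ (a₁ ∸ suc i)) a₁ ⟨
    sumBelow (λ i → carry′ i + carry′ (a₁ ∸ suc i)) a₁   ≡⟨ sumBelow-cong _ _ a₁ complement ⟩
    sumBelow (λ _ → d₁) a₁                               ≡⟨ sumBelow-const d₁ a₁ ⟩
    a₁ * d₁                                              ∎
    where
    open ≡-Reasoning
    carry′ : ℕ → ℕ
    carry′ i = carry (suc i)
    carry0≡0 : carry 0 ≡ 0
    carry0≡0 = cong (_/ a) (*-zeroʳ d)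
    complement : ∀ i → i < a₁ → carry′ i + carry′ (a₁ ∸ suc i) ≡ d₁
    complement i i<a₁ = carry-complement (suc i) (suc (a₁ ∸ suc i)) (s≤s z≤n) (s≤s i<a₁)
      (cong suc (trans (+-suc i (a₁ ∸ suc i)) (m+[n∸m]≡n i<a₁)))

module AperySet (a₁ h d₁ k : ℕ) (coprime : Coprime (suc a₁) (suc d₁))
                (m<a : suc (suc (2 * k)) ≤ suc a₁) where

  open Residues a₁ d₁ coprime public
  open MinimalPartition k public

  A : Vec ℕ (suc (suc k))
  A = genVec a h d k

  aperyQuotient : ℕ → ℕ
  aperyQuotient Y = h * minParts Y + carry Y

  aperyElement : ℕ → ℕ
  aperyElement Y = h * a * minParts Y + d * Y

  aperyElement≡ : ∀ Y → aperyElement Y ≡ residue Y + aperyQuotient Y * a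
  aperyElement≡ Y = trans (cong (h * a * minParts Y +_) (dY≡ Y)) (lemma h a (minParts Y) (residue Y) (carry Y))
    where lemma : ∀ h a X R B → h * a * X + (R + B * a) ≡ R + (h * X + B) * a
          lemma = solve-∀

  representable-aboveApery : ∀ Y z → aperyQuotient Y ≤ z → RepresentableXY a (h * a) d k (residue Y + z * a)
  representable-aboveApery Y z q≤z = z ∸ aperyQuotient Y , minParts Y , Y , minParts-oddPartition Y , (begin
    residue Y + z * a
      ≡⟨ cong (λ u → residue Y + u * a) (m∸n+n≡m q≤z) ⟨
    residue Y + (z ∸ aperyQuotient Y + aperyQuotient Y) * a
      ≡⟨ lemma (residue Y) (z ∸ aperyQuotient Y) h (minParts Y) (carry Y) a ⟩
    a * (z ∸ aperyQuotient Y) + h * a * minParts Y + (residue Y + carry Y * a)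
      ≡⟨ cong (a * (z ∸ aperyQuotient Y) + h * a * minParts Y +_) (dY≡ Y) ⟨
    a * (z ∸ aperyQuotient Y) + h * a * minParts Y + d * Y ∎)
    where
    open ≡-Reasoning
    lemma : ∀ R w h X B a → R + (w + (h * X + B)) * a ≡ a * w + h * a * X + (R + B * a)
    lemma = solve-∀

  -- A representation uses some Y′ ≡ Y (mod a); if Y′ ≠ Y then Y′ ≥ Y + a ≥ Y + m + 1,
  -- which already needs at least minParts Y odd parts.
  representable⇒aperyQuotient≤ : ∀ Y z → Y < a → RepresentableXY a (h * a) d k (residue Y + z * a) →
                                 aperyQuotient Y ≤ z
  representable⇒aperyQuotient≤ Y z Y<a (x₀ , X , Y′ , part , n≡) = begin
    h * minParts Y + carry Y                  ≤⟨ +-monoˡ-≤ (carry Y) (*-monoʳ-≤ h minParts≤X) ⟩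
    h * X + carry Y                           ≤⟨ m≤n+m _ x₀ ⟩
    x₀ + (h * X + carry Y)                    ≡⟨ +-assoc x₀ (h * X) (carry Y) ⟨
    x₀ + h * X + carry Y                      ≤⟨ m≤m+n _ (d * c) ⟩
    x₀ + h * X + carry Y + d * c              ≡⟨ z≡ ⟨
    z                                         ∎
    where
    open ≤-Reasoning
    c = Y′ / a
    lemma₁ : ∀ a x₀ h X d Y′ → a * x₀ + h * a * X + d * Y′ ≡ d * Y′ + (x₀ + h * X) * a
    lemma₁ = solve-∀
    Y′≡ : Y′ ≡ Y + c * a
    Y′≡ = residue-determines Y Y′ z (x₀ + h * X) Y<a (trans n≡ (lemma₁ a x₀ h X d Y′))
    lemma₂ : ∀ a x₀ h X R B d c → a * x₀ + h * a * X + (R + B * a + d * (c * a)) ≡ R + (x₀ + h * X + B + d * c) * a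
    lemma₂ = solve-∀
    z≡ : z ≡ x₀ + h * X + carry Y + d * c
    z≡ = *-cancelʳ-≡ z _ a (+-cancelˡ-≡ (residue Y) _ _ (begin-equality
      residue Y + z * a                                          ≡⟨ n≡ ⟩
      a * x₀ + h * a * X + d * Y′                                ≡⟨ cong (λ u → a * x₀ + h * a * X + d * u) Y′≡ ⟩
      a * x₀ + h * a * X + d * (Y + c * a)
        ≡⟨ cong (a * x₀ + h * a * X +_) (trans (*-distribˡ-+ d Y (c * a)) (cong (_+ d * (c * a)) (dY≡ Y))) ⟩
      a * x₀ + h * a * X + (residue Y + carry Y * a + d * (c * a)) ≡⟨ lemma₂ a x₀ h X (residue Y) (carry Y) d c ⟩
      residue Y + (x₀ + h * X + carry Y + d * c) * a             ∎))
    minParts≤X : minParts Y ≤ X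
    minParts≤X with c | Y′≡
    ... | zero    | Y′≡Y+0 = minParts-minimal Y X (subst (OddPartition k X) (trans Y′≡Y+0 (+-identityʳ Y)) part)
    ... | suc c₁ | Y′≡Y+ = minParts-≤-of-gap Y X Y′ part
            (≤-trans (+-monoʳ-≤ Y (≤-trans m<a (m≤m+n a (c₁ * a)))) (≤-reflexive (sym Y′≡Y+)))

  BelowApery : ℕ → Set
  BelowApery n = ∃ λ Y → Y < a × ∃ λ z → z < aperyQuotient Y × n ≡ residue Y + z * a

  nonRepresentable⇒belowApery : ∀ n → ¬ Representable A n → BelowApery n
  nonRepresentable⇒belowApery n ¬rep = below (residue-surjective n)
    where
    below : (∃ λ Y → Y < a × n ≡ residue Y + n / a * a) → BelowApery n
    below (Y , Y<a , n≡) = Y , Y<a , n / a , ≰⇒> (λ q≤ → ¬rep (XY⇒representable a h d k n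
      (subst (RepresentableXY a (h * a) d k) (sym n≡) (representable-aboveApery Y (n / a) q≤)))) , n≡

  belowApery⇒nonRepresentable : ∀ n → BelowApery n → ¬ Representable A n
  belowApery⇒nonRepresentable n (Y , Y<a , z , z<q , n≡) rep = <⇒≱ z<q
    (representable⇒aperyQuotient≤ Y z Y<a (subst (RepresentableXY a (h * a) d k) n≡ (representable⇒XY a h d k n rep)))

  gapBlock : ℕ → List ℕ
  gapBlock Y = map (λ z → residue Y + z * a) (upTo (aperyQuotient Y))

  gapList : ℕ → List ℕ
  gapList zero    = []
  gapList (suc n) = gapList n ++ gapBlock n

  length-gapList : ∀ n → length (gapList n) ≡ sumBelow aperyQuotient n
  length-gapList zero    = refl
  length-gapList (suc n) = trans (length-++ (gapList n))
    (cong₂ _+_ (length-gapList n) (trans (length-map _ (upTo (aperyQuotient n))) (length-upTo (aperyQuotient n))))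

  ∈-gapBlock⁻ : ∀ {x} Y → x ∈ gapBlock Y → ∃ λ z → z < aperyQuotient Y × x ≡ residue Y + z * a
  ∈-gapBlock⁻ Y x∈ with ∈-map⁻ (λ z → residue Y + z * a) x∈
  ... | z , z∈ , x≡ = z , ∈-upTo⁻ z∈ , x≡

  ∈-gapList⁻ : ∀ {x} n → x ∈ gapList n → ∃ λ Y → Y < n × ∃ λ z → z < aperyQuotient Y × x ≡ residue Y + z * a
  ∈-gapList⁻ (suc n) x∈ with ∈-++⁻ (gapList n) x∈
  ... | inj₁ x∈₁ = let Y , Y<n , rest = ∈-gapList⁻ n x∈₁ in Y , m<n⇒m<1+n Y<n , rest
  ... | inj₂ x∈₂ = n , ≤-refl , ∈-gapBlock⁻ n x∈₂

  ∈-gapList⁺ : ∀ n Y z → Y < n → z < aperyQuotient Y → residue Y + z * a ∈ gapList n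
  ∈-gapList⁺ (suc n) Y z Y<1+n z<q with m≤n⇒m<n∨m≡n (≤-pred Y<1+n)
  ... | inj₁ Y<n  = ∈-++⁺ˡ (∈-gapList⁺ n Y z Y<n z<q)
  ... | inj₂ refl = ∈-++⁺ʳ (gapList n) (∈-map⁺ (λ z → residue Y + z * a) (∈-upTo⁺ z<q))

  gapList-unique : ∀ n → n ≤ a → Unique (gapList n)
  gapList-unique zero    _   = []
  gapList-unique (suc n) n<a = ++⁺ (gapList-unique n (≤-trans (n≤1+n n) n<a)) block-unique disjoint
    where
    block-unique : Unique (gapBlock n)
    block-unique = map⁺ (λ {x} {y} eq → *-cancelʳ-≡ x y a (+-cancelˡ-≡ (residue n) _ _ eq)) (upTo⁺ (aperyQuotient n))
    residue-of : ∀ Y z → (residue Y + z * a) % a ≡ residue Y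
    residue-of Y z = trans ([m+kn]%n≡m%n (residue Y) z a) (m<n⇒m%n≡m (residue<a Y))
    disjoint : ∀ {v} → ¬ (v ∈ gapList n × v ∈ gapBlock n)
    disjoint (v∈₁ , v∈₂) with ∈-gapList⁻ n v∈₁ | ∈-gapBlock⁻ n v∈₂
    ... | Y , Y<n , z , _ , v≡ | z′ , _ , v≡′ = <-irrefl
      (residue-injective Y n (<-≤-trans Y<n (≤-trans (n≤1+n n) n<a)) n<a
        (trans (sym (residue-of Y z)) (trans (cong (_% a) (trans (sym v≡) v≡′)) (residue-of n z′))))
      Y<n

  belowApery⇒∈gapList : ∀ {n} → BelowApery n → n ∈ gapList a
  belowApery⇒∈gapList (Y , Y<a , z , z<q , n≡) = subst (_∈ gapList a) (sym n≡) (∈-gapList⁺ a Y z Y<a z<q)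

  sylvesterNumber : IsSylvesterNumber A (sumBelow aperyQuotient a)
  sylvesterNumber = gapList a , gapList-unique a ≤-refl ,
    (λ n → (λ n∈ → belowApery⇒nonRepresentable n (∈-gapList⁻ a n∈)) ,
           (λ ¬rep → belowApery⇒∈gapList (nonRepresentable⇒belowApery n ¬rep))) ,
    length-gapList a

  belowApery⇒+a≤aperyElement : ∀ {n} → BelowApery n → ∃ λ Y → Y < a × n + a ≤ aperyElement Y
  belowApery⇒+a≤aperyElement {n} (Y , Y<a , z , z<q , n≡) = Y , Y<a , (begin
    n + a                           ≡⟨ cong (_+ a) n≡ ⟩
    residue Y + z * a + a           ≡⟨ lemma (residue Y) z a ⟩
    residue Y + suc z * a           ≤⟨ +-monoʳ-≤ (residue Y) (*-monoˡ-≤ a z<q) ⟩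
    residue Y + aperyQuotient Y * a ≡⟨ aperyElement≡ Y ⟨
    aperyElement Y                  ∎)
    where
    open ≤-Reasoning
    lemma : ∀ R z a → R + z * a + a ≡ R + suc z * a
    lemma = solve-∀

  aperyElement-≤ : ∀ {Y Y′ X} → minParts Y ≤ X → Y ≤ Y′ → aperyElement Y ≤ h * a * X + Y′ * d
  aperyElement-≤ {Y′ = Y′} parts≤ Y≤Y′ =
    +-mono-≤ (*-monoʳ-≤ (h * a) parts≤) (≤-trans (*-monoʳ-≤ d Y≤Y′) (≤-reflexive (*-comm d Y′)))

  frobeniusNumber-of-bound : ∀ M Y₀ → Y₀ < a → 0 < aperyQuotient Y₀ → aperyElement Y₀ ≡ M →
                             (∀ Y → Y < a → aperyElement Y ≤ M) → IsFrobeniusNumber A (M ∸ a)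
  frobeniusNumber-of-bound .(aperyElement Y₀) Y₀ Y₀<a 0<q refl max = ¬rep , upper
    where
    q₁ = aperyQuotient Y₀ ∸ 1
    q≡ : aperyQuotient Y₀ ≡ suc q₁
    q≡ = sym (m+[n∸m]≡n 0<q)
    G≡ : aperyElement Y₀ ∸ a ≡ residue Y₀ + q₁ * a
    G≡ = begin
      aperyElement Y₀ ∸ a                    ≡⟨ cong (_∸ a) (aperyElement≡ Y₀) ⟩
      residue Y₀ + aperyQuotient Y₀ * a ∸ a  ≡⟨ cong (λ u → residue Y₀ + u * a ∸ a) q≡ ⟩
      residue Y₀ + suc q₁ * a ∸ a            ≡⟨ cong (_∸ a) (lemma (residue Y₀) q₁ a) ⟩
      a + (residue Y₀ + q₁ * a) ∸ a          ≡⟨ m+n∸m≡n a _ ⟩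
      residue Y₀ + q₁ * a                    ∎
      where
      open ≡-Reasoning
      lemma : ∀ R q a → R + suc q * a ≡ a + (R + q * a)
      lemma = solve-∀
    ¬rep : ¬ Representable A (aperyElement Y₀ ∸ a)
    ¬rep = belowApery⇒nonRepresentable _ (Y₀ , Y₀<a , q₁ , subst (q₁ <_) (sym q≡) ≤-refl , G≡)
    upper : ∀ n → ¬ Representable A n → n ≤ aperyElement Y₀ ∸ a
    upper n ¬rep′ = bound (belowApery⇒+a≤aperyElement (nonRepresentable⇒belowApery n ¬rep′))
      where
      bound : (∃ λ Y → Y < a × n + a ≤ aperyElement Y) → n ≤ aperyElement Y₀ ∸ a
      bound (Y , Y<a , n+a≤) = m+n≤o⇒m≤o∸n n (≤-trans n+a≤ (max Y Y<a))

-- Here a − 1 = t + s m with t = t₁ + 1 ≤ m = 2k + 1. The largest Apéry element is at Y = a − 1, except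
-- that for odd t ≥ 3 the one at Y = a − 2 needs an extra odd part and may be larger.
module Formulas (t₁ s h₁ d₁ k : ℕ) (0<k : 0 < k) (t₁<m : t₁ < suc (2 * k))
                (coprime : Coprime (suc (suc (t₁ + s * suc (2 * k)))) (suc d₁))
                (m<a : suc (suc (2 * k)) ≤ suc (suc (t₁ + s * suc (2 * k)))) where

  a₁ h : ℕ
  a₁ = suc (t₁ + s * suc (2 * k))
  h  = suc h₁

  open AperySet a₁ h d₁ k coprime m<a

  quotient-top : (t₁ + s * m) / m ≡ s
  quotient-top = proj₁ (div-mod-unique (t₁ + s * m) m s t₁ t₁<m refl)

  minParts-top : minParts a₁ ≡ suc (s + t₁ % 2)
  minParts-top = cong suc (minParts′-value s t₁ t₁<m)

  quotient≤s : ∀ {y} → y ≤ t₁ + s * m → y / m ≤ s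
  quotient≤s y≤ = ≤-trans (/-monoˡ-≤ m y≤) (≤-reflexive quotient-top)

  minParts≤s+2 : ∀ Y → Y ≤ a₁ → minParts Y ≤ s + 2
  minParts≤s+2 zero    _        = z≤n
  minParts≤s+2 (suc y) (s≤s y≤) = begin
    suc (y / m + y % m % 2)  ≤⟨ s≤s (+-mono-≤ (quotient≤s y≤) (%2≤1 (y % m))) ⟩
    suc (s + 1)              ≡⟨ +-suc s 1 ⟨
    s + 2                    ∎
    where open ≤-Reasoning

  -- With t₁ even, an odd remainder y mod m ≤ t₁ must lie strictly below t₁.
  minParts-excess : t₁ % 2 ≡ 0 → ∀ Y → Y ≤ a₁ → minParts Y ≤ s + 1 ⊎ (Y < a₁ × 0 < t₁)
  minParts-excess t₁-even zero _ = inj₁ z≤n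
  minParts-excess t₁-even (suc y) (s≤s y≤)
    with m≤n⇒m<n∨m≡n (quotient≤s y≤) | even-or-odd (y % m)
  ... | inj₁ q<s | _ = inj₁ (begin
    suc (y / m + y % m % 2)  ≤⟨ s≤s (+-monoʳ-≤ (y / m) (%2≤1 (y % m))) ⟩
    suc (y / m + 1)          ≡⟨ cong suc (+-comm (y / m) 1) ⟩
    suc (suc (y / m))        ≤⟨ s≤s q<s ⟩
    suc s                    ≡⟨ +-comm 1 s ⟩
    s + 1                    ∎)
    where open ≤-Reasoning
  ... | inj₂ q≡s | inj₁ (r%2≡0 , _) = inj₁ (≤-reflexive (begin-equality
    suc (y / m + y % m % 2)  ≡⟨ cong₂ (λ u v → suc (u + v)) q≡s r%2≡0 ⟩
    suc (s + 0)              ≡⟨ cong suc (+-identityʳ s) ⟩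
    suc s                    ≡⟨ +-comm 1 s ⟩
    s + 1                    ∎))
    where open ≤-Reasoning
  ... | inj₂ q≡s | inj₂ (r%2≡1 , _) = inj₂ (s≤s (subst (λ u → suc u ≤ t₁ + s * m) (sym y≡) (+-monoˡ-≤ (s * m) r<t₁)) ,
                                            ≤-trans (s≤s z≤n) r<t₁)
    where
    r = y % m
    y≡ : y ≡ r + s * m
    y≡ = trans (m≡m%n+[m/n]*n y m) (cong (λ u → r + u * m) q≡s)
    r≢t₁ : r ≢ t₁
    r≢t₁ r≡t₁ = 1+n≢0 (trans (sym r%2≡1) (trans (cong (_% 2) r≡t₁) t₁-even))
    r<t₁ : r < t₁
    r<t₁ = ≤∧≢⇒< (+-cancelʳ-≤ (s * m) r t₁ (subst (_≤ t₁ + s * m) y≡ y≤)) r≢t₁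

  F₁ F₂ : ℕ
  F₁ = h * a * (s + 1) + a₁ * d
  F₂ = h * a * ((t₁ + s * m ∸ 1) / m + 2) + (t₁ + s * m) * d

  aperyElement-top : t₁ % 2 ≡ 0 → aperyElement a₁ ≡ F₁
  aperyElement-top t₁-even = cong₂ _+_ (cong (h * a *_) minParts≡) (*-comm d a₁)
    where
    minParts≡ : minParts a₁ ≡ s + 1
    minParts≡ = trans minParts-top (trans (cong (λ p → suc (s + p)) t₁-even)
                  (trans (cong suc (+-identityʳ s)) (+-comm 1 s)))

  frobenius-even : suc t₁ % 2 ≡ 0 →
    IsFrobeniusNumber A (h * a * ((a ∸ 2) / (1 + 2 * k) + 2) + (a ∸ 1) * d ∸ a)
  frobenius-even t-even = subst (λ q → IsFrobeniusNumber A (h * a * (q + 2) + a₁ * d ∸ a)) (sym quotient-top)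
    (frobeniusNumber-of-bound _ a₁ ≤-refl (s≤s z≤n) top≡ bound)
    where
    top≡ : aperyElement a₁ ≡ h * a * (s + 2) + a₁ * d
    top≡ = cong₂ _+_ (cong (h * a *_) (trans minParts-top
             (trans (cong (λ p → suc (s + p)) (odd-of-suc-even t₁ t-even)) (sym (+-suc s 1))))) (*-comm d a₁)
    bound : ∀ Y → Y < a → aperyElement Y ≤ h * a * (s + 2) + a₁ * d
    bound Y Y<a = aperyElement-≤ (minParts≤s+2 Y (≤-pred Y<a)) (≤-pred Y<a)

  frobenius-odd-t≡1 : t₁ ≡ 0 → IsFrobeniusNumber A ((F₁ ⊔ F₂) ∸ a)
  frobenius-odd-t≡1 t₁≡0 = subst (λ M → IsFrobeniusNumber A (M ∸ a)) (sym (m≥n⇒m⊔n≡m F₂≤F₁))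
    (frobeniusNumber-of-bound F₁ a₁ ≤-refl (s≤s z≤n) (aperyElement-top t₁-even) bound)
    where
    t₁-even : t₁ % 2 ≡ 0
    t₁-even = cong (_% 2) t₁≡0
    0<sm : 0 < s * m
    0<sm = ≤-trans (≤-trans 0<k (m≤m+n k (k + 0))) (subst (λ t → 2 * k ≤ t + s * m) t₁≡0 (≤-pred (≤-pred m<a)))
    q<s : (t₁ + s * m ∸ 1) / m < s
    q<s = m<n*o⇒m/o<n (subst (λ t → t + s * m ∸ 1 < s * m) (sym t₁≡0) (∸-monoʳ-< (s≤s z≤n) 0<sm))
    F₂≤F₁ : F₂ ≤ F₁
    F₂≤F₁ = +-mono-≤ (*-monoʳ-≤ (h * a) (≤-trans (≤-reflexive (+-suc _ 1)) (+-monoˡ-≤ 1 q<s)))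
                     (*-monoˡ-≤ d (n≤1+n (t₁ + s * m)))
    bound : ∀ Y → Y < a → aperyElement Y ≤ F₁
    bound Y Y<a with minParts-excess t₁-even Y (≤-pred Y<a)
    ... | inj₁ parts≤ = aperyElement-≤ parts≤ (≤-pred Y<a)
    ... | inj₂ (_ , 0<t₁) = ⊥-elim (<-irrefl (sym t₁≡0) 0<t₁)

  frobenius-odd-t≥3 : t₁ % 2 ≡ 0 → ∀ t₂ → t₁ ≡ suc t₂ → IsFrobeniusNumber A ((F₁ ⊔ F₂) ∸ a)
  frobenius-odd-t≥3 t₁-even t₂ t₁≡ = subst (λ M → IsFrobeniusNumber A ((F₁ ⊔ M) ∸ a)) (sym F₂≡E₂)
    ([ (λ ⊔≡F₁ → frobeniusNumber-of-bound _ a₁ ≤-refl (s≤s z≤n) (trans (aperyElement-top t₁-even) (sym ⊔≡F₁)) bound)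
     , (λ ⊔≡E₂ → frobeniusNumber-of-bound _ Y₂ (m<n⇒m<1+n (n<1+n Y₂)) Y₂-pos (trans second≡E₂ (sym ⊔≡E₂)) bound)
     ]′ (⊔-sel F₁ E₂))
    where
    Y₂ E₂ : ℕ
    Y₂ = t₁ + s * m
    E₂ = h * a * (s + 2) + Y₂ * d
    Y₂≡ : Y₂ ≡ suc (t₂ + s * m)
    Y₂≡ = cong (_+ s * m) t₁≡
    t₂<m : t₂ < m
    t₂<m = <-trans (n<1+n t₂) (subst (_< m) t₁≡ t₁<m)
    F₂≡E₂ : F₂ ≡ E₂
    F₂≡E₂ = cong (λ q → h * a * (q + 2) + Y₂ * d)
              (trans (cong (λ Y → (Y ∸ 1) / m) Y₂≡) (proj₁ (div-mod-unique (t₂ + s * m) m s t₂ t₂<m refl)))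
    second≡E₂ : aperyElement Y₂ ≡ E₂
    second≡E₂ = cong₂ _+_ (cong (h * a *_) (begin-equality
      minParts Y₂                   ≡⟨ cong minParts Y₂≡ ⟩
      suc (minParts′ (t₂ + s * m))  ≡⟨ cong suc (minParts′-value s t₂ t₂<m) ⟩
      suc (s + t₂ % 2)              ≡⟨ cong (λ p → suc (s + p)) (odd-of-suc-even t₂ (subst (λ t → t % 2 ≡ 0) t₁≡ t₁-even)) ⟩
      suc (s + 1)                   ≡⟨ +-suc s 1 ⟨
      s + 2                         ∎)) (*-comm d Y₂)
      where open ≤-Reasoning
    Y₂-pos : 0 < aperyQuotient Y₂
    Y₂-pos = subst (λ Y → 0 < aperyQuotient Y) (sym Y₂≡) (s≤s z≤n)
    bound : ∀ Y → Y < a → aperyElement Y ≤ F₁ ⊔ E₂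
    bound Y Y<a with minParts-excess t₁-even Y (≤-pred Y<a)
    ... | inj₁ parts≤      = ≤-trans (aperyElement-≤ parts≤ (≤-pred Y<a)) (m≤m⊔n F₁ E₂)
    ... | inj₂ (Y<a₁ , _) = ≤-trans (aperyElement-≤ (minParts≤s+2 Y (≤-pred Y<a)) (≤-pred Y<a₁)) (m≤n⊔m F₁ E₂)

  frobenius-odd : suc t₁ % 2 ≡ 1 →
    IsFrobeniusNumber A ((h * a * ((a ∸ 2) / (1 + 2 * k) + 1) + (a ∸ 1) * d ∸ a)
                           ⊔ (h * a * ((a ∸ 3) / (1 + 2 * k) + 2) + (a ∸ 2) * d ∸ a))
  frobenius-odd t-odd = subst (IsFrobeniusNumber A) G≡ (by-t₁ t₁ refl)
    where
    t₁-even = even-of-suc-odd t₁ t-odd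
    G≡ : (F₁ ⊔ F₂) ∸ a ≡ (h * a * ((t₁ + s * m) / m + 1) + a₁ * d ∸ a) ⊔ (F₂ ∸ a)
    G≡ = trans (∸-distribʳ-⊔ a F₁ F₂) (cong (λ q → (h * a * (q + 1) + a₁ * d ∸ a) ⊔ (F₂ ∸ a)) (sym quotient-top))
    by-t₁ : ∀ t → t ≡ t₁ → IsFrobeniusNumber A ((F₁ ⊔ F₂) ∸ a)
    by-t₁ zero     0≡t₁   = frobenius-odd-t≡1 (sym 0≡t₁)
    by-t₁ (suc t₂) t₂+1≡t₁ = frobenius-odd-t≥3 t₁-even t₂ (sym t₂+1≡t₁)

  sylvester : ∃ λ N → IsSylvesterNumber A N ×
    2 * N ≡ h * s * (2 * k * s + 2 * suc t₁ + s ∸ 1) + (a ∸ 1) * (d + 2 * h ∸ 1) + 2 * (h * (suc t₁ / 2))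
  sylvester = N , sylvesterNumber , +-cancelʳ-≡ (h * (m * s)) _ _ (begin
    2 * N + h * (m * s)
      ≡⟨ cong (λ u → 2 * u + h * (m * s)) N≡ ⟩
    2 * (h * (a₁ * 1 + S′) + C) + h * (m * s)
      ≡⟨ lemma₁ h a₁ S′ C m s ⟩
    h * (2 * S′ + m * s) + h * (2 * a₁) + 2 * C
      ≡⟨ cong₂ (λ u v → h * u + h * (2 * a₁) + v) (sum-minParts′ s (suc t₁) t₁<m) (sum-carry) ⟩
    h * (m * s * s + 2 * k * s + 2 * s * suc t₁ + 2 * W) + h * (2 * a₁) + a₁ * d₁
      ≡⟨ lemma₂ h₁ s k t₁ d₁ W ⟩
    h * s * (2 * k * s + 2 * t₁ + 1 + s) + a₁ * (d₁ + 2 * h) + 2 * (h * W) + h * (m * s)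
      ≡⟨ cong (λ u → h * s * u + a₁ * (d₁ + 2 * h) + 2 * (h * W) + h * (m * s)) (cong (_∸ 1) (lemma₃ k s t₁)) ⟨
    h * s * (2 * k * s + 2 * suc t₁ + s ∸ 1) + a₁ * (d₁ + 2 * h) + 2 * (h * W) + h * (m * s) ∎)
    where
    open ≡-Reasoning
    N S′ C W : ℕ
    N  = sumBelow aperyQuotient a
    S′ = sumBelow minParts′ a₁
    C  = sumBelow carry a
    W  = suc t₁ / 2
    N≡ : N ≡ h * (a₁ * 1 + S′) + C
    N≡ = trans (sumBelow-+ (λ Y → h * minParts Y) carry a)
           (cong (_+ C) (trans (sumBelow-* h minParts a) (cong (h *_) (sum-minParts a₁))))
    lemma₁ : ∀ h a₁ S C m s → 2 * (h * (a₁ * 1 + S) + C) + h * (m * s) ≡ h * (2 * S + m * s) + h * (2 * a₁) + 2 * C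
    lemma₁ = solve-∀
    lemma₂ : ∀ h₁ s k t₁ d₁ W →
      suc h₁ * (suc (2 * k) * s * s + 2 * k * s + 2 * s * suc t₁ + 2 * W) + suc h₁ * (2 * suc (t₁ + s * suc (2 * k)))
        + suc (t₁ + s * suc (2 * k)) * d₁
      ≡ suc h₁ * s * (2 * k * s + 2 * t₁ + 1 + s) + suc (t₁ + s * suc (2 * k)) * (d₁ + 2 * suc h₁)
        + 2 * (suc h₁ * W) + suc h₁ * (suc (2 * k) * s)
    lemma₂ = solve-∀
    lemma₃ : ∀ k s t₁ → 2 * k * s + 2 * suc t₁ + s ≡ suc (2 * k * s + 2 * t₁ + 1 + s)
    lemma₃ = solve-∀

a-1≡ : ∀ k s t₁ → (2 * k + 1) * s + suc t₁ ≡ suc (t₁ + s * suc (2 * k))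
a-1≡ = solve-∀

theorem4p3 : (a h d k : ℕ) → 0 < a → 0 < h → 0 < d → 0 < k →
    gcd a d ≡ 1 → 2 < a → 3 ≤ 2 * k + 1 → 2 * k + 1 ≤ a ∸ 1 →
    (s t : ℕ) → a ∸ 1 ≡ (2 * k + 1) * s + t → 1 ≤ t → t ≤ 2 * k + 1 →
    (t % 2 ≡ 0 →
      IsFrobeniusNumber (genVec a h d k)
        (h * a * ((a ∸ 2) / (1 + 2 * k) + 2) + (a ∸ 1) * d ∸ a))
    × (t % 2 ≡ 1 →
      IsFrobeniusNumber (genVec a h d k)
        ((h * a * ((a ∸ 2) / (1 + 2 * k) + 1) + (a ∸ 1) * d ∸ a)
          ⊔ (h * a * ((a ∸ 3) / (1 + 2 * k) + 2) + (a ∸ 2) * d ∸ a)))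
    × (∃ λ N → IsSylvesterNumber (genVec a h d k) N ×
      2 * N ≡ h * s * (2 * k * s + 2 * t + s ∸ 1)
              + (a ∸ 1) * (d + 2 * h ∸ 1) + 2 * (h * (t / 2)))
theorem4p3 (suc a₁) (suc h₁) (suc d₁) k _ _ _ 0<k gcd≡1 _ _ m≤a₁ s (suc t₁) a₁≡ (s≤s z≤n) t≤m
  with refl ← trans a₁≡ (a-1≡ k s t₁) =
  frobenius-even , frobenius-odd , sylvester
  where
  m≡ : 2 * k + 1 ≡ suc (2 * k)
  m≡ = +-comm (2 * k) 1
  open Formulas t₁ s h₁ d₁ k 0<k (subst (suc t₁ ≤_) m≡ t≤m) (gcd≡1⇒coprime gcd≡1) (s≤s (subst (_≤ suc (t₁ + s * suc (2 * k))) m≡ m≤a₁))
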